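{- Let $p\geq 5$ be a prime number and $n\geq 1$. Let $a,b$ be integers not divisible by $p$ with $a+p\mathbb{Z}\neq b+p\mathbb{Z}$. If the $(a+p\mathbb{Z},b+p\mathbb{Z})$-dynomial minimal solution of $(E_{\mathbb{Z}/p\mathbb{Z}})$ is irreducible, then the $(a+p^n\mathbb{Z},b+p^n\mathbb{Z})$-dynomial minimal solution of $(E_{\mathbb{Z}/p^n\mathbb{Z}})$ is irreducible.
   Context: For a commutative unital ring $A$ and $a_1,\ldots,a_n\in A$ set $M_n(a_1,\ldots,a_n)=\begin{pmatrix} a_n & -1_A\\ 1_A & 0_A\end{pmatrix}\cdots\begin{pmatrix} a_1 & -1_A\\ 1_A & 0_A\end{pmatrix}$. An $n$-tuple is a solution of $(E_A)$ if $M_n(a_1,\ldots,a_n)=\pm \mathrm{Id}$. For tuples, $(a_1,\ldots,a_n)\oplus(b_1,\ldots,b_m)=(a_1+b_m,a_2,\ldots,a_{n-1},a_n+b_1,b_2,\ldots,b_{m-1})$. Write $(a_1,\ldots,a_n)\sim(b_1,\ldots,b_n)$ if $(b_1,\ldots,b_n)$ is obtained from $(a_1,\ldots,a_n)$ or from $(a_n,\ldots,a_1)$ by a cyclic permutation. A solution $(c_1,\ldots,c_n)$ with $n\geq 3$ is reducible if there exist a solution $(b_1,\ldots,b_l)$ and a tuple $(a_1,\ldots,a_m)$ with $l,m\geq 3$ and $(c_1,\ldots,c_n)\sim(a_1,\ldots,a_m)\oplus(b_1,\ldots,b_l)$; otherwise irreducible. For $A$ finite and $a\neq b$ in $A$,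 the $(a,b)$-dynomial minimal solution of $(E_A)$ is the solution of the form $(a,b,\ldots,a,b)$ (pair $(a,b)$ repeated $k\geq1$ times) of minimal size; it exists. -}

module Defs where

open import Data.Nat using (ℕ; zero; suc; _≤_; _<_)
open import Data.Integer using (ℤ; +_; -_; _+_; _-_; _*_)
open import Data.Integer.Divisibility using (_∣_)
open import Data.List using (List; []; _∷_; _++_; [_]; length; reverse; take; drop)
open import Data.List.Relation.Binary.Pointwise using (Pointwise)
open import Data.Product using (Σ; _×_; ∃; ∃-syntax)
open import Data.Sum using (_⊎_)
open import Relation.Nullary using (¬_)

-- The ring ℤ/mℤ is represented by integer representatives, with equality
-- in ℤ/mℤ given by congruence modulo m.
_≈[_]_ : ℤ → ℕ → ℤ → Set
x ≈[ m ] y = (+ m) ∣ (x - y)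

record Mat : Set where
  constructor mat
  field
    m11 m12 m21 m22 : ℤ

_⊗_ : Mat → Mat → Mat
mat a b c d ⊗ mat e f g h =
  mat (a * e + b * g) (a * f + b * h) (c * e + d * g) (c * f + d * h)

Id : Mat
Id = mat (+ 1) (+ 0) (+ 0) (+ 1)

-Id : Mat
-Id = mat (- + 1) (+ 0) (+ 0) (- + 1)

Ma : ℤ → Mat
Ma a = mat a (- + 1) (+ 1) (+ 0)

-- M_n(a_1,...,a_n) = Ma(a_n) ⋯ Ma(a_1), computed left to right over the list
Mprod-acc : Mat → List ℤ → Mat
Mprod-acc acc [] = acc
Mprod-acc acc (a ∷ as) = Mprod-acc (Ma a ⊗ acc) as

Mn : List ℤ → Mat
Mn = Mprod-acc Id

MatEq : ℕ → Mat → Mat → Set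
MatEq m (mat a b c d) (mat e f g h) =
  (a ≈[ m ] e) × (b ≈[ m ] f) × (c ≈[ m ] g) × (d ≈[ m ] h)

Solution : ℕ → List ℤ → Set
Solution m l = MatEq m (Mn l) Id ⊎ MatEq m (Mn l) -Id

-- helpers for ⊕ (only used on lists of length ≥ 3)
lastOr0 : List ℤ → ℤ
lastOr0 [] = + 0
lastOr0 (x ∷ []) = x
lastOr0 (x ∷ y ∷ xs) = lastOr0 (y ∷ xs)

dropLast : List ℤ → List ℤ
dropLast [] = []
dropLast (x ∷ []) = []
dropLast (x ∷ y ∷ xs) = x ∷ dropLast (y ∷ xs)

-- (a_1,...,a_n) ⊕ (b_1,...,b_m)
--   = (a_1 + b_m, a_2, ..., a_{n-1}, a_n + b_1, b_2, ..., b_{m-1})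
_⊕_ : List ℤ → List ℤ → List ℤ
[] ⊕ bs = bs
(a₁ ∷ as) ⊕ [] = a₁ ∷ as
(a₁ ∷ as) ⊕ (b₁ ∷ bs) =
  (a₁ + lastOr0 bs) ∷ (dropLast as ++ [ lastOr0 as + b₁ ] ++ dropLast bs)

rotate : ℕ → List ℤ → List ℤ
rotate k l = drop k l ++ take k l

TupleEq : ℕ → List ℤ → List ℤ → Set
TupleEq m = Pointwise (λ x y → x ≈[ m ] y)

Equiv : ℕ → List ℤ → List ℤ → Set
Equiv m c d =
  ∃[ k ] (k < length c × (TupleEq m d (rotate k c) ⊎ TupleEq m d (rotate k (reverse c))))

Reducible : ℕ → List ℤ → Set
Reducible m c =
  ∃[ as ] ∃[ bs ] (3 ≤ length as × 3 ≤ length bs × Solution m bs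
                    × Equiv m c (as ⊕ bs))

Irreducible : ℕ → List ℤ → Set
Irreducible m c = Solution m c × 3 ≤ length c × ¬ Reducible m c

dyn : ℤ → ℤ → ℕ → List ℤ
dyn a b zero = []
dyn a b (suc k) = a ∷ b ∷ dyn a b k

IsDynMinSol : ℕ → ℤ → ℤ → ℕ → Set
IsDynMinSol m a b k =
  1 ≤ k × Solution m (dyn a b k)
  × (∀ j → 1 ≤ j → j < k → ¬ Solution m (dyn a b j))

-- A reducible solution c ∼ as ⊕ bs contains the inner part B of bs as a cyclic block, and
-- bs is a solution exactly when M(B) has (1,1) entry ±1. For the cyclic word (a,b)^k′ these
-- blocks are alternating words. An even block is (x,y)^j, whose matrix is P^j for
-- P = M(x,y); writing P^j = u P + v Id, a (1,1) entry δ = ±1 forces u (u - δ) x y ≡ 0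
-- mod p^n, so P^j or P^(j+1) is ±Id mod p^n, against the minimality of k′. An odd block is
-- read modulo p, where (b,a)^k is a solution; its length can then be reduced modulo 2k,
-- which yields a reduction of the irreducible (a,b)^k modulo p.

module Submission where

open import Defs
open import Data.Nat as ℕ using (ℕ; zero; suc; _≤_; _<_; _^_; z≤n; s≤s)
import Data.Nat.Properties as ℕ
import Data.Nat.Divisibility as ℕ
open import Data.Nat.DivMod using (_%_; _/_; m≡m%n+[m/n]*n; m%n<n)
open import Data.Nat.Primality using (Prime; euclidsLemma; prime⇒nonZero; prime⇒nonTrivial)
open import Data.Integer using (ℤ; +_; -_; _+_; _-_; _*_; ∣_∣; 0ℤ; 1ℤ; -1ℤ)
import Data.Integer.Properties as ℤ
open import Data.Integer.Divisibility using (_∣_)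
import Data.Integer.Divisibility.Signed as Signed
open import Data.Integer.Tactic.RingSolver using (solve-∀)
open import Data.Nat.Tactic.RingSolver using () renaming (solve-∀ to ℕ-solve-∀)
open import Data.List using (List; []; _∷_; _++_; [_]; _∷ʳ_; length; reverse; take; drop)
import Data.List.Properties as List
open import Data.List.Relation.Binary.Pointwise as Pointwise using (Pointwise; []; _∷_; Pointwise-length)
open import Data.Product using (_×_; _,_; proj₁; proj₂; swap; ∃-syntax)
open import Data.Sum as Sum using (_⊎_; inj₁; inj₂)
open import Data.Empty using (⊥; ⊥-elim)
open import Function using (id; _∘_)
open import Relation.Nullary using (¬_; yes; no)
open import Relation.Binary.PropositionalEquality
  using (_≡_; refl; sym; trans; cong; cong₂; subst; module ≡-Reasoning)

open Mat using (m11; m12; m21; m22)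

private
  variable
    m n k j : ℕ
    a b x x′ y y′ z z′ δ ε : ℤ
    l l′ : List ℤ

-- Congruences in ℤ

-- x ≈[ m ] y computes to a statement about ∣ x - y ∣, so x and y cannot be recovered
-- from its type; this equivalent relation keeps them as indices.
infix 4 _≡_[mod_]
record _≡_[mod_] (x y : ℤ) (m : ℕ) : Set where
  constructor mod-∣
  field ∣-difference : + m Signed.∣ x - y

≈⇒≡mod : x ≈[ m ] y → x ≡ y [mod m ]
≈⇒≡mod h = mod-∣ (Signed.∣ᵤ⇒∣ h)

≡mod⇒≈ : x ≡ y [mod m ] → x ≈[ m ] y
≡mod⇒≈ (mod-∣ h) = Signed.∣⇒∣ᵤ h

≡0⇒∣ : x ≡ 0ℤ [mod m ] → + m ∣ x
≡0⇒∣ {x = x} {m = m} h = subst (+ m ∣_) (ℤ.+-identityʳ x) (≡mod⇒≈ h)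

∣⇒≡0 : + m ∣ x → x ≡ 0ℤ [mod m ]
∣⇒≡0 {m = m} {x = x} h = ≈⇒≡mod (subst (+ m ∣_) (sym (ℤ.+-identityʳ x)) h)

≡-combination₁ : ∀ c → z - z′ ≡ c * (x - x′) → x ≡ x′ [mod m ] → z ≡ z′ [mod m ]
≡-combination₁ c eq (mod-∣ h) =
  mod-∣ (subst (_ Signed.∣_) (sym eq) (Signed.∣n⇒∣m*n c h))

≡-combination₂ : ∀ c₁ c₂ → z - z′ ≡ c₁ * (x - x′) + c₂ * (y - y′) →
                 x ≡ x′ [mod m ] → y ≡ y′ [mod m ] → z ≡ z′ [mod m ]
≡-combination₂ c₁ c₂ eq (mod-∣ h₁) (mod-∣ h₂) =
  mod-∣ (subst (_ Signed.∣_) (sym eq)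
    (Signed.∣m∣n⇒∣m+n (Signed.∣n⇒∣m*n c₁ h₁) (Signed.∣n⇒∣m*n c₂ h₂)))

≡-combination₃ : ∀ c₁ c₂ c₃ → z - z′ ≡ c₁ * (x - x′) + c₂ * (y - y′) + c₃ * (a - b) →
                 x ≡ x′ [mod m ] → y ≡ y′ [mod m ] → a ≡ b [mod m ] → z ≡ z′ [mod m ]
≡-combination₃ c₁ c₂ c₃ eq (mod-∣ h₁) (mod-∣ h₂) (mod-∣ h₃) =
  mod-∣ (subst (_ Signed.∣_) (sym eq)
    (Signed.∣m∣n⇒∣m+n (Signed.∣m∣n⇒∣m+n (Signed.∣n⇒∣m*n c₁ h₁) (Signed.∣n⇒∣m*n c₂ h₂))
                      (Signed.∣n⇒∣m*n c₃ h₃)))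

≡-refl : x ≡ x [mod m ]
≡-refl {x = x} = mod-∣ (subst (_ Signed.∣_) (sym (ℤ.+-inverseʳ x)) (Signed.∣n⇒∣m*n 0ℤ Signed.∣-refl))

≡-sym : x ≡ y [mod m ] → y ≡ x [mod m ]
≡-sym {x = x} {y = y} = ≡-combination₁ -1ℤ (identity x y)
  where
  identity : ∀ x y → y - x ≡ -1ℤ * (x - y)
  identity = solve-∀

≡-trans : x ≡ y [mod m ] → y ≡ z [mod m ] → x ≡ z [mod m ]
≡-trans {x = x} {y = y} {z = z} = ≡-combination₂ 1ℤ 1ℤ (identity x y z)
  where
  identity : ∀ x y z → x - z ≡ 1ℤ * (x - y) + 1ℤ * (y - z)
  identity = solve-∀

≡-+ : x ≡ x′ [mod m ] → y ≡ y′ [mod m ] → x + y ≡ x′ + y′ [mod m ]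
≡-+ {x = x} {x′ = x′} {y = y} {y′ = y′} = ≡-combination₂ 1ℤ 1ℤ (identity x x′ y y′)
  where
  identity : ∀ x x′ y y′ → x + y - (x′ + y′) ≡ 1ℤ * (x - x′) + 1ℤ * (y - y′)
  identity = solve-∀

≡-* : x ≡ x′ [mod m ] → y ≡ y′ [mod m ] → x * y ≡ x′ * y′ [mod m ]
≡-* {x = x} {x′ = x′} {y = y} {y′ = y′} = ≡-combination₂ y x′ (identity x x′ y y′)
  where
  identity : ∀ x x′ y y′ → x * y - x′ * y′ ≡ y * (x - x′) + x′ * (y - y′)
  identity = solve-∀

≡-mod-∣ : ∀ {d} → d ℕ.∣ m → x ≡ y [mod m ] → x ≡ y [mod d ]
≡-mod-∣ d∣m (mod-∣ h) = mod-∣ (Signed.∣-trans (Signed.∣ᵤ⇒∣ d∣m) h)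

≡-reflexive : x ≡ y → x ≡ y [mod m ]
≡-reflexive refl = ≡-refl

-- Primes and units

prime⇒2≤ : ∀ {p} → Prime p → 2 ≤ p
prime⇒2≤ {p} p-prime = ℕ.nonTrivial⇒n>1 p {{prime⇒nonTrivial p-prime}}

prime-*≢0 : ∀ {p} → Prime p → ¬ (x ≡ 0ℤ [mod p ]) → ¬ (y ≡ 0ℤ [mod p ]) → ¬ (x * y ≡ 0ℤ [mod p ])
prime-*≢0 {x = x} {y = y} {p = p} p-prime x≢0 y≢0 xy≡0
  with euclidsLemma ∣ x ∣ ∣ y ∣ p-prime (subst (p ℕ.∣_) (ℤ.abs-* x y) (≡0⇒∣ xy≡0))
... | inj₁ p∣x = x≢0 (∣⇒≡0 p∣x)
... | inj₂ p∣y = y≢0 (∣⇒≡0 p∣y)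

prime-power-∣-cancelʳ : ∀ {p c} n a → Prime p → ¬ (p ℕ.∣ c) →
                        p ^ n ℕ.∣ a ℕ.* c → p ^ n ℕ.∣ a
prime-power-∣-cancelʳ zero a _ _ _ = ℕ.1∣ a
prime-power-∣-cancelʳ {p} {c} (suc n) a p-prime p∤c p^[1+n]∣ac
  with euclidsLemma a c p-prime (ℕ.∣-trans (ℕ.m∣m*n (p ^ n)) p^[1+n]∣ac)
... | inj₂ p∣c = ⊥-elim (p∤c p∣c)
... | inj₁ (ℕ.divides q refl) = subst (p ^ suc n ℕ.∣_) (ℕ.*-comm p q) (ℕ.*-monoʳ-∣ p p^n∣q)
  where
  instance
    p-nonZero : ℕ.NonZero p
    p-nonZero = prime⇒nonZero p-prime
  p^n∣q : p ^ n ℕ.∣ q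
  p^n∣q = prime-power-∣-cancelʳ n q p-prime p∤c (ℕ.*-cancelˡ-∣ p
    (subst (p ^ suc n ℕ.∣_) (trans (cong (ℕ._* c) (ℕ.*-comm q p)) (ℕ.*-assoc p q c)) p^[1+n]∣ac))

prime-power-cancelʳ : ∀ {p} → Prime p → ∀ n x → ¬ (y ≡ 0ℤ [mod p ]) →
                      x * y ≡ 0ℤ [mod p ^ n ] → x ≡ 0ℤ [mod p ^ n ]
prime-power-cancelʳ {y = y} {p = p} p-prime n x y≢0 xy≡0 =
  ∣⇒≡0 (prime-power-∣-cancelʳ n ∣ x ∣ p-prime (λ p∣y → y≢0 (∣⇒≡0 p∣y))
    (subst (p ^ n ℕ.∣_) (ℤ.abs-* x y) (≡0⇒∣ xy≡0)))

IsUnit : ℤ → Set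
IsUnit δ = δ ≡ 1ℤ ⊎ δ ≡ -1ℤ

unit-neg : IsUnit δ → IsUnit (- δ)
unit-neg (inj₁ refl) = inj₂ refl
unit-neg (inj₂ refl) = inj₁ refl

unit-* : IsUnit δ → IsUnit ε → IsUnit (δ * ε)
unit-* (inj₁ refl) ε-unit = subst IsUnit (sym (ℤ.*-identityˡ _)) ε-unit
unit-* (inj₂ refl) ε-unit = subst IsUnit (sym (ℤ.-1*i≡-i _)) (unit-neg ε-unit)

unit-square : IsUnit δ → δ * δ ≡ 1ℤ [mod m ]
unit-square (inj₁ refl) = ≡-refl
unit-square (inj₂ refl) = ≡-refl

unit-≢0 : 2 ≤ m → IsUnit δ → ¬ (δ ≡ 0ℤ [mod m ])
unit-≢0 2≤m (inj₁ refl) 1≡0 = ℕ.<⇒≢ 2≤m (sym (ℕ.∣1⇒≡1 (≡0⇒∣ 1≡0)))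
unit-≢0 2≤m (inj₂ refl) -1≡0 = ℕ.<⇒≢ 2≤m (sym (ℕ.∣1⇒≡1 (≡0⇒∣ -1≡0)))

-- p cannot divide both u and u - δ, so p ^ n divides one of them.
u[u-δ]c≡0⇒u≡0∨u≡δ : ∀ {p u c} → Prime p → IsUnit δ → ¬ (c ≡ 0ℤ [mod p ]) →
                     u * (u - δ) * c ≡ 0ℤ [mod p ^ n ] → u ≡ 0ℤ [mod p ^ n ] ⊎ u ≡ δ [mod p ^ n ]
u[u-δ]c≡0⇒u≡0∨u≡δ {δ = δ} {n = n} {p = p} {u = u} {c = c} p-prime δ-unit c≢0 h with p ℕ.∣? ∣ u ∣
... | yes p∣u = inj₁ (prime-power-cancelʳ p-prime n u (prime-*≢0 p-prime u-δ≢0 c≢0)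
                       (≡-combination₁ 1ℤ (u[[u-δ]c] u δ c) h))
  where
  u[[u-δ]c] : ∀ u δ c → u * ((u - δ) * c) - 0ℤ ≡ 1ℤ * (u * (u - δ) * c - 0ℤ)
  u[[u-δ]c] = solve-∀
  δ≡u-[u-δ] : ∀ u δ → δ - 0ℤ ≡ 1ℤ * (u - 0ℤ) + -1ℤ * ((u - δ) - 0ℤ)
  δ≡u-[u-δ] = solve-∀
  u-δ≢0 : ¬ (u - δ ≡ 0ℤ [mod p ])
  u-δ≢0 u-δ≡0 = unit-≢0 (prime⇒2≤ p-prime) δ-unit
                  (≡-combination₂ 1ℤ -1ℤ (δ≡u-[u-δ] u δ) (∣⇒≡0 {x = u} p∣u) u-δ≡0)
... | no p∤u = inj₂ (≡-combination₁ 1ℤ (u-δ≡[u-δ]-0 u δ)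
                 (prime-power-cancelʳ p-prime n (u - δ) (prime-*≢0 {x = u} p-prime (p∤u ∘ ≡0⇒∣) c≢0)
                   (≡-combination₁ 1ℤ ([u-δ][uc] u δ c) h)))
  where
  [u-δ][uc] : ∀ u δ c → (u - δ) * (u * c) - 0ℤ ≡ 1ℤ * (u * (u - δ) * c - 0ℤ)
  [u-δ][uc] = solve-∀
  u-δ≡[u-δ]-0 : ∀ u δ → u - δ ≡ 1ℤ * ((u - δ) - 0ℤ)
  u-δ≡[u-δ]-0 = solve-∀

-- 2 × 2 matrices

mat-cong : ∀ {a a′ b b′ c c′ d d′} → a ≡ a′ → b ≡ b′ → c ≡ c′ → d ≡ d′ →
           mat a b c d ≡ mat a′ b′ c′ d′
mat-cong refl refl refl refl = refl

⊗-assoc : ∀ A B C → (A ⊗ B) ⊗ C ≡ A ⊗ (B ⊗ C)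
⊗-assoc (mat a b c d) (mat e f g h) (mat i j k l) =
  mat-cong (entry a b e f g h i k) (entry a b e f g h j l) (entry c d e f g h i k) (entry c d e f g h j l)
  where
  entry : ∀ a b e f g h i k →
          (a * e + b * g) * i + (a * f + b * h) * k ≡ a * (e * i + f * k) + b * (g * i + h * k)
  entry = solve-∀

⊗-identityʳ : ∀ A → A ⊗ Id ≡ A
⊗-identityʳ (mat a b c d) = mat-cong (left a b) (right a b) (left c d) (right c d)
  where
  left : ∀ a b → a * 1ℤ + b * 0ℤ ≡ a
  left = solve-∀
  right : ∀ a b → a * 0ℤ + b * 1ℤ ≡ b
  right = solve-∀

Mprod-acc≡Mn⊗ : ∀ acc l → Mprod-acc acc l ≡ Mn l ⊗ acc
Mprod-acc≡Mn⊗ acc [] = mat-cong (top (m11 acc) (m21 acc)) (top (m12 acc) (m22 acc))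
                                (bottom (m11 acc) (m21 acc)) (bottom (m12 acc) (m22 acc))
  where
  top : ∀ a c → a ≡ 1ℤ * a + 0ℤ * c
  top = solve-∀
  bottom : ∀ a c → c ≡ 0ℤ * a + 1ℤ * c
  bottom = solve-∀
Mprod-acc≡Mn⊗ acc (a ∷ l) = begin
  Mprod-acc (Ma a ⊗ acc) l      ≡⟨ Mprod-acc≡Mn⊗ (Ma a ⊗ acc) l ⟩
  Mn l ⊗ (Ma a ⊗ acc)           ≡⟨ ⊗-assoc (Mn l) (Ma a) acc ⟨
  (Mn l ⊗ Ma a) ⊗ acc           ≡⟨ cong (λ M → (Mn l ⊗ M) ⊗ acc) (⊗-identityʳ (Ma a)) ⟨
  (Mn l ⊗ (Ma a ⊗ Id)) ⊗ acc    ≡⟨ cong (_⊗ acc) (Mprod-acc≡Mn⊗ (Ma a ⊗ Id) l) ⟨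
  Mn (a ∷ l) ⊗ acc              ∎
  where open ≡-Reasoning

Mn-∷ : ∀ a l → Mn (a ∷ l) ≡ Mn l ⊗ Ma a
Mn-∷ a l = trans (Mprod-acc≡Mn⊗ (Ma a ⊗ Id) l) (cong (Mn l ⊗_) (⊗-identityʳ (Ma a)))

Mprod-acc-++ : ∀ acc l l′ → Mprod-acc acc (l ++ l′) ≡ Mprod-acc (Mprod-acc acc l) l′
Mprod-acc-++ acc [] l′ = refl
Mprod-acc-++ acc (a ∷ l) l′ = Mprod-acc-++ (Ma a ⊗ acc) l l′

Mn-++ : ∀ l l′ → Mn (l ++ l′) ≡ Mn l′ ⊗ Mn l
Mn-++ l l′ = trans (Mprod-acc-++ Id l l′) (Mprod-acc≡Mn⊗ (Mn l) l′)

Mn-∷-∷ʳ : ∀ x l y → Mn (x ∷ (l ∷ʳ y)) ≡ (Ma y ⊗ Mn l) ⊗ Ma x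
Mn-∷-∷ʳ x l y = trans (Mn-∷ x (l ∷ʳ y)) (cong (_⊗ Ma x) (Mprod-acc-++ Id l [ y ]))

det : Mat → ℤ
det (mat a b c d) = a * d - b * c

det-⊗ : ∀ A B → det (A ⊗ B) ≡ det A * det B
det-⊗ (mat a b c d) (mat e f g h) = identity a b c d e f g h
  where
  identity : ∀ a b c d e f g h → (a * e + b * g) * (c * f + d * h) - (a * f + b * h) * (c * e + d * g)
                                 ≡ (a * d - b * c) * (e * h - f * g)
  identity = solve-∀

det-Mn : ∀ l → det (Mn l) ≡ 1ℤ
det-Mn [] = refl
det-Mn (a ∷ l) = begin
  det (Mn (a ∷ l))            ≡⟨ cong det (Mn-∷ a l) ⟩
  det (Mn l ⊗ Ma a)           ≡⟨ det-⊗ (Mn l) (Ma a) ⟩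
  det (Mn l) * det (Ma a)     ≡⟨ cong₂ _*_ (det-Mn l) (det-Ma a) ⟩
  1ℤ                          ∎
  where
  open ≡-Reasoning
  det-Ma : ∀ a → a * 0ℤ - -1ℤ * 1ℤ ≡ 1ℤ
  det-Ma = solve-∀

infix 4 _≡ᴹ_[mod_]
_≡ᴹ_[mod_] : Mat → Mat → ℕ → Set
A ≡ᴹ B [mod m ] = m11 A ≡ m11 B [mod m ] × m12 A ≡ m12 B [mod m ]
                × m21 A ≡ m21 B [mod m ] × m22 A ≡ m22 B [mod m ]

⊗-cong : ∀ A A′ B B′ → A ≡ᴹ A′ [mod m ] → B ≡ᴹ B′ [mod m ] → A ⊗ B ≡ᴹ A′ ⊗ B′ [mod m ]
⊗-cong _ _ _ _ (a , b , c , d) (e , f , g , h) =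
  ≡-+ (≡-* a e) (≡-* b g) , ≡-+ (≡-* a f) (≡-* b h) ,
  ≡-+ (≡-* c e) (≡-* d g) , ≡-+ (≡-* c f) (≡-* d h)

Mprod-acc-cong : ∀ acc acc′ → acc ≡ᴹ acc′ [mod m ] → TupleEq m l l′ →
                 Mprod-acc acc l ≡ᴹ Mprod-acc acc′ l′ [mod m ]
Mprod-acc-cong acc acc′ acc≡ [] = acc≡
Mprod-acc-cong acc acc′ acc≡ (_∷_ {x = x} {y = y} x≈y l≈l′) =
  Mprod-acc-cong (Ma x ⊗ acc) (Ma y ⊗ acc′)
    (⊗-cong (Ma x) (Ma y) acc acc′ (≈⇒≡mod x≈y , ≡-refl , ≡-refl , ≡-refl) acc≡) l≈l′

m11-Mn-cong : TupleEq m l l′ → m11 (Mn l) ≡ m11 (Mn l′) [mod m ]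
m11-Mn-cong l≈l′ = proj₁ (Mprod-acc-cong Id Id (≡-refl , ≡-refl , ≡-refl , ≡-refl) l≈l′)

scalar : ℤ → Mat
scalar δ = mat δ 0ℤ 0ℤ δ

solution⇒scalar : ∀ l → Solution m l → ∃[ δ ] (IsUnit δ × Mn l ≡ᴹ scalar δ [mod m ])
solution⇒scalar _ (inj₁ (e₁₁ , e₁₂ , e₂₁ , e₂₂)) =
  1ℤ , inj₁ refl , ≈⇒≡mod e₁₁ , ≈⇒≡mod e₁₂ , ≈⇒≡mod e₂₁ , ≈⇒≡mod e₂₂
solution⇒scalar _ (inj₂ (e₁₁ , e₁₂ , e₂₁ , e₂₂)) =
  -1ℤ , inj₂ refl , ≈⇒≡mod e₁₁ , ≈⇒≡mod e₁₂ , ≈⇒≡mod e₂₁ , ≈⇒≡mod e₂₂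

scalar⇒solution : ∀ l → IsUnit δ → Mn l ≡ᴹ scalar δ [mod m ] → Solution m l
scalar⇒solution _ (inj₁ refl) (e₁₁ , e₁₂ , e₂₁ , e₂₂) =
  inj₁ (≡mod⇒≈ e₁₁ , ≡mod⇒≈ e₁₂ , ≡mod⇒≈ e₂₁ , ≡mod⇒≈ e₂₂)
scalar⇒solution _ (inj₂ refl) (e₁₁ , e₁₂ , e₂₁ , e₂₂) =
  inj₂ (≡mod⇒≈ e₁₁ , ≡mod⇒≈ e₁₂ , ≡mod⇒≈ e₂₁ , ≡mod⇒≈ e₂₂)

solution-∷⇒m11≡0 : ∀ z l → Solution m (z ∷ l) → m11 (Mn l) ≡ 0ℤ [mod m ]
solution-∷⇒m11≡0 {m = m} z l sol with solution⇒scalar (z ∷ l) sol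
... | δ , _ , Mn≡δ with subst (λ M → M ≡ᴹ scalar δ [mod m ]) (Mn-∷ z l) Mn≡δ
...   | _ , e₁₂ , _ , _ = ≡-combination₁ -1ℤ (identity (m11 (Mn l)) (m12 (Mn l))) e₁₂
  where
  identity : ∀ a b → a - 0ℤ ≡ -1ℤ * ((a * -1ℤ + b * 0ℤ) - 0ℤ)
  identity = solve-∀

solution⇒corner : ∀ x B y → Solution m (x ∷ (B ∷ʳ y)) → ∃[ δ ] (IsUnit δ × m11 (Mn B) ≡ δ [mod m ])
solution⇒corner {m = m} x B y sol with solution⇒scalar (x ∷ (B ∷ʳ y)) sol
... | δ , δ-unit , Mn≡δ with subst (λ M → M ≡ᴹ scalar δ [mod m ]) (Mn-∷-∷ʳ x B y) Mn≡δ
...   | _ , _ , _ , e₂₂ =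
  - δ , unit-neg δ-unit , ≡-combination₁ -1ℤ (identity (m11 (Mn B)) (m12 (Mn B)) (m21 (Mn B)) (m22 (Mn B)) δ) e₂₂
  where
  identity : ∀ a b c d δ →
             a - - δ ≡ -1ℤ * ((1ℤ * a + 0ℤ * c) * -1ℤ + (1ℤ * b + 0ℤ * d) * 0ℤ - δ)
  identity = solve-∀

corner-completion : ∀ X → IsUnit δ → det X ≡ 1ℤ → m11 X ≡ δ [mod m ] →
  (Ma (δ * m21 X) ⊗ X) ⊗ Ma ((- δ) * m12 X) ≡ᴹ scalar (- δ) [mod m ]
corner-completion {δ = δ} X δ-unit det≡1 corner =
  ≡-combination₃ (δ * X₂₂ - δ * δ * X₁₂ * X₂₁) (X₂₂ - δ * X₁₂ * X₂₁) (- δ)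
    (e₁₁ X₁₁ X₁₂ X₂₁ X₂₂ δ) corner δ² det≡1′ ,
  ≡-combination₂ ((- δ) * X₂₁) (- X₂₁) (e₁₂ X₁₁ X₁₂ X₂₁ X₂₂ δ) corner δ² ,
  ≡-combination₂ ((- δ) * X₁₂) (- X₁₂) (e₂₁ X₁₁ X₁₂ X₂₁ X₂₂ δ) corner δ² ,
  ≡-combination₁ -1ℤ (e₂₂ X₁₁ X₁₂ X₂₁ X₂₂ δ) corner
  where
  X₁₁ X₁₂ X₂₁ X₂₂ : ℤ
  X₁₁ = m11 X
  X₁₂ = m12 X
  X₂₁ = m21 X
  X₂₂ = m22 X
  δ² : δ * δ ≡ 1ℤ [mod _ ]
  δ² = unit-square δ-unit
  det≡1′ : X₁₁ * X₂₂ - X₁₂ * X₂₁ ≡ 1ℤ [mod _ ]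
  det≡1′ = ≡-reflexive det≡1
  e₁₁ : ∀ a b c d δ →
    (δ * c * a + -1ℤ * c) * ((- δ) * b) + (δ * c * b + -1ℤ * d) * 1ℤ - - δ
    ≡ (δ * d - δ * δ * b * c) * (a - δ) + (d - δ * b * c) * (δ * δ - 1ℤ) + (- δ) * (a * d - b * c - 1ℤ)
  e₁₁ = solve-∀
  e₁₂ : ∀ a b c d δ →
    (δ * c * a + -1ℤ * c) * -1ℤ + (δ * c * b + -1ℤ * d) * 0ℤ - 0ℤ
    ≡ ((- δ) * c) * (a - δ) + (- c) * (δ * δ - 1ℤ)
  e₁₂ = solve-∀
  e₂₁ : ∀ a b c d δ →
    (1ℤ * a + 0ℤ * c) * ((- δ) * b) + (1ℤ * b + 0ℤ * d) * 1ℤ - 0ℤ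
    ≡ ((- δ) * b) * (a - δ) + (- b) * (δ * δ - 1ℤ)
  e₂₁ = solve-∀
  e₂₂ : ∀ a b c d δ →
    (1ℤ * a + 0ℤ * c) * -1ℤ + (1ℤ * b + 0ℤ * d) * 0ℤ - - δ ≡ -1ℤ * (a - δ)
  e₂₂ = solve-∀

completion : ℤ → List ℤ → List ℤ
completion δ B = ((- δ) * m12 (Mn B)) ∷ (B ∷ʳ (δ * m21 (Mn B)))

corner⇒solution : ∀ B → IsUnit δ → m11 (Mn B) ≡ δ [mod m ] → Solution m (completion δ B)
corner⇒solution {δ = δ} {m = m} B δ-unit corner =
  scalar⇒solution (completion δ B) (unit-neg δ-unit)
    (subst (λ M → M ≡ᴹ scalar (- δ) [mod m ]) (sym (Mn-∷-∷ʳ ((- δ) * m12 (Mn B)) B (δ * m21 (Mn B))))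
      (corner-completion (Mn B) δ-unit (det-Mn B) corner))

-- Reducibility through blocks with a unit corner

lastOr0-∷ʳ : ∀ l z → lastOr0 (l ∷ʳ z) ≡ z
lastOr0-∷ʳ [] z = refl
lastOr0-∷ʳ (x ∷ []) z = refl
lastOr0-∷ʳ (x ∷ y ∷ l) z = lastOr0-∷ʳ (y ∷ l) z

dropLast-∷ʳ : ∀ l z → dropLast (l ∷ʳ z) ≡ l
dropLast-∷ʳ [] z = refl
dropLast-∷ʳ (x ∷ []) z = refl
dropLast-∷ʳ (x ∷ y ∷ l) z = cong (x ∷_) (dropLast-∷ʳ (y ∷ l) z)

dropLast-∷ʳ-lastOr0 : ∀ x l → dropLast (x ∷ l) ∷ʳ lastOr0 (x ∷ l) ≡ x ∷ l
dropLast-∷ʳ-lastOr0 x [] = refl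
dropLast-∷ʳ-lastOr0 x (y ∷ l) = cong (x ∷_) (dropLast-∷ʳ-lastOr0 y l)

length-dropLast : ∀ x l → length (dropLast (x ∷ l)) ≡ length l
length-dropLast x [] = refl
length-dropLast x (y ∷ l) = cong suc (length-dropLast y l)

3≤length-∷-∷ʳ : ∀ {A : Set} (x : A) l y → 1 ≤ length l → 3 ≤ length (x ∷ (l ∷ʳ y))
3≤length-∷-∷ʳ x l y 1≤|l| rewrite List.length-++ l {[ y ]} = s≤s (ℕ.+-monoˡ-≤ 1 1≤|l|)

⊕-∷≡++ : ∀ α as β bs →
         (α ∷ as) ⊕ (β ∷ bs) ≡ ((α + lastOr0 bs) ∷ (dropLast as ∷ʳ (lastOr0 as + β))) ++ dropLast bs
⊕-∷≡++ α as β bs = cong ((α + lastOr0 bs) ∷_) (sym (List.++-assoc (dropLast as) [ lastOr0 as + β ] (dropLast bs)))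

i-j+j≡i : ∀ i j → i - j + j ≡ i
i-j+j≡i = solve-∀

detach : ℤ → ℤ → ℤ → List ℤ → List ℤ
detach β β′ r R = (r - β′) ∷ (dropLast R ∷ʳ (lastOr0 R - β))

detach-⊕ : ∀ β β′ r r′ R B → detach β β′ r (r′ ∷ R) ⊕ (β ∷ (B ∷ʳ β′)) ≡ (r ∷ r′ ∷ R) ++ B
detach-⊕ β β′ r r′ R B
  rewrite lastOr0-∷ʳ B β′ | dropLast-∷ʳ B β′
        | lastOr0-∷ʳ (dropLast (r′ ∷ R)) (lastOr0 (r′ ∷ R) - β) | dropLast-∷ʳ (dropLast (r′ ∷ R)) (lastOr0 (r′ ∷ R) - β)
        | i-j+j≡i r β′ | i-j+j≡i (lastOr0 (r′ ∷ R)) β =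
  cong (r ∷_) (trans (sym (List.++-assoc (dropLast (r′ ∷ R)) [ lastOr0 (r′ ∷ R) ] B))
                     (cong (_++ B) (dropLast-∷ʳ-lastOr0 r′ R)))

-- In as ⊕ bs the inner part B of bs appears as a block, and bs is a solution exactly when
-- M(B) has a unit (1,1) entry (given that, the ends of bs are determined by M(B)).
record BlockSplit (m : ℕ) (c : List ℤ) : Set where
  constructor blockSplit
  field
    prefix block : List ℤ
    σ : ℤ
    3≤length-prefix : 3 ≤ length prefix
    1≤length-block : 1 ≤ length block
    σ-unit : IsUnit σ
    corner : m11 (Mn block) ≡ σ [mod m ]
    c∼prefix++block : Equiv m c (prefix ++ block)

reducible⇒blockSplit : Reducible m l → BlockSplit m l
reducible⇒blockSplit ([] , _ , () , _)
reducible⇒blockSplit (_ ∷ [] , _ , s≤s () , _)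
reducible⇒blockSplit (_ ∷ _ ∷ _ , [] , _ , () , _)
reducible⇒blockSplit (_ ∷ _ ∷ _ , _ ∷ [] , _ , s≤s () , _)
reducible⇒blockSplit {m = m} {l = l}
  (α ∷ a₂ ∷ as , β ∷ b₂ ∷ bs , s≤s (s≤s 1≤|as|) , s≤s (s≤s 1≤|bs|) , sol , l∼as⊕bs)
  with solution⇒corner β (dropLast (b₂ ∷ bs)) (lastOr0 (b₂ ∷ bs))
         (subst (Solution m) (cong (β ∷_) (sym (dropLast-∷ʳ-lastOr0 b₂ bs))) sol)
... | σ , σ-unit , corner =
  blockSplit prefix (dropLast (b₂ ∷ bs)) σ
    (3≤length-∷-∷ʳ (α + lastOr0 (b₂ ∷ bs)) (dropLast (a₂ ∷ as)) (lastOr0 (a₂ ∷ as) + β)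
      (subst (1 ≤_) (sym (length-dropLast a₂ as)) 1≤|as|))
    (subst (1 ≤_) (sym (length-dropLast b₂ bs)) 1≤|bs|)
    σ-unit corner
    (subst (Equiv m l) (⊕-∷≡++ α (a₂ ∷ as) β (b₂ ∷ bs)) l∼as⊕bs)
  where
  prefix : List ℤ
  prefix = (α + lastOr0 (b₂ ∷ bs)) ∷ (dropLast (a₂ ∷ as) ∷ʳ (lastOr0 (a₂ ∷ as) + β))

blockSplit⇒reducible : BlockSplit m l → Reducible m l
blockSplit⇒reducible (blockSplit [] _ _ () _ _ _ _)
blockSplit⇒reducible (blockSplit (_ ∷ []) _ _ (s≤s ()) _ _ _ _)
blockSplit⇒reducible {m = m} {l = l}
  (blockSplit (r ∷ r′ ∷ R) B σ (s≤s (s≤s 1≤|R|)) 1≤|B| σ-unit corner l∼R++B) =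
  detach β β′ r (r′ ∷ R) , completion σ B ,
  3≤length-∷-∷ʳ (r - β′) (dropLast (r′ ∷ R)) (lastOr0 (r′ ∷ R) - β)
    (subst (1 ≤_) (sym (length-dropLast r′ R)) 1≤|R|) ,
  3≤length-∷-∷ʳ β B β′ 1≤|B| ,
  corner⇒solution B σ-unit corner ,
  subst (Equiv m l) (sym (detach-⊕ β β′ r r′ R B)) l∼R++B
  where
  β β′ : ℤ
  β = (- σ) * m12 (Mn B)
  β′ = σ * m21 (Mn B)

-- Alternating words

alternate : ℤ × ℤ → ℕ → List ℤ
alternate _ zero = []
alternate (x , y) (suc n) = x ∷ alternate (y , x) n

shift : ℕ → ℤ × ℤ → ℤ × ℤ
shift zero q = q
shift (suc r) q = shift r (swap q)

dyn≡alternate : ∀ x y k → dyn x y k ≡ alternate (x , y) (k ℕ.+ k)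
dyn≡alternate x y zero = refl
dyn≡alternate x y (suc k) rewrite ℕ.+-suc k k = cong (λ l → x ∷ y ∷ l) (dyn≡alternate x y k)

length-alternate : ∀ q n → length (alternate q n) ≡ n
length-alternate q zero = refl
length-alternate (x , y) (suc n) = cong suc (length-alternate (y , x) n)

length-dyn : ∀ x y k → length (dyn x y k) ≡ k ℕ.+ k
length-dyn x y k = trans (cong length (dyn≡alternate x y k)) (length-alternate (x , y) (k ℕ.+ k))

alternate-+ : ∀ q i j → alternate q (i ℕ.+ j) ≡ alternate q i ++ alternate (shift i q) j
alternate-+ q zero j = refl
alternate-+ (x , y) (suc i) j = cong (x ∷_) (alternate-+ (y , x) i j)

shift-+ : ∀ i j q → shift (i ℕ.+ j) q ≡ shift j (shift i q)
shift-+ zero j q = refl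
shift-+ (suc i) j q = shift-+ i j (swap q)

shift-even : ∀ k q → shift (k ℕ.+ k) q ≡ q
shift-even zero q = refl
shift-even (suc k) q rewrite ℕ.+-suc k k = shift-even k q

take-alternate : ∀ q {r n} → r ≤ n → take r (alternate q n) ≡ alternate q r
take-alternate q z≤n = refl
take-alternate (x , y) (s≤s r≤n) = cong (x ∷_) (take-alternate (y , x) r≤n)

drop-alternate : ∀ q {r n} → r ≤ n → drop r (alternate q n) ≡ alternate (shift r q) (n ℕ.∸ r)
drop-alternate q z≤n = refl
drop-alternate (x , y) (s≤s r≤n) = drop-alternate (y , x) r≤n

rotate-alternate : ∀ q {r n} → r ≤ n → rotate r (alternate q n) ≡ alternate (shift r q) (n ℕ.∸ r) ++ alternate q r
rotate-alternate q r≤n = cong₂ _++_ (drop-alternate q r≤n) (take-alternate q r≤n)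

rotate-dyn : ∀ x y {r} k → r ≤ k ℕ.+ k → rotate r (dyn x y k) ≡ alternate (shift r (x , y)) (k ℕ.+ k)
rotate-dyn x y {r} k r≤N = begin
  rotate r (dyn x y k)                                 ≡⟨ cong (rotate r) (dyn≡alternate x y k) ⟩
  rotate r (alternate q N)                             ≡⟨ rotate-alternate q r≤N ⟩
  alternate (shift r q) (N ℕ.∸ r) ++ alternate q r     ≡⟨ cong (λ q′ → alternate (shift r q) (N ℕ.∸ r) ++ alternate q′ r) q-returns ⟨
  alternate (shift r q) (N ℕ.∸ r) ++ alternate (shift (N ℕ.∸ r) (shift r q)) r
                                                       ≡⟨ alternate-+ (shift r q) (N ℕ.∸ r) r ⟨
  alternate (shift r q) (N ℕ.∸ r ℕ.+ r)                ≡⟨ cong (alternate (shift r q)) (ℕ.m∸n+n≡m r≤N) ⟩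
  alternate (shift r q) N                              ∎
  where
  open ≡-Reasoning
  q : ℤ × ℤ
  q = (x , y)
  N : ℕ
  N = k ℕ.+ k
  q-returns : shift (N ℕ.∸ r) (shift r q) ≡ q
  q-returns = trans (sym (shift-+ r (N ℕ.∸ r) q)) (trans (cong (λ i → shift i q) (ℕ.m+[n∸m]≡n r≤N)) (shift-even k q))

dyn-∷ʳ : ∀ x y k → dyn x y k ++ (x ∷ y ∷ []) ≡ x ∷ y ∷ dyn x y k
dyn-∷ʳ x y zero = refl
dyn-∷ʳ x y (suc k) = cong (λ l → x ∷ y ∷ l) (dyn-∷ʳ x y k)

reverse-dyn : ∀ x y k → reverse (dyn x y k) ≡ dyn y x k
reverse-dyn x y zero = refl
reverse-dyn x y (suc k) = begin
  reverse (x ∷ y ∷ dyn x y k)          ≡⟨ List.reverse-++ (x ∷ y ∷ []) (dyn x y k) ⟩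
  reverse (dyn x y k) ++ (y ∷ x ∷ [])  ≡⟨ cong (_++ (y ∷ x ∷ [])) (reverse-dyn x y k) ⟩
  dyn y x k ++ (y ∷ x ∷ [])            ≡⟨ dyn-∷ʳ y x k ⟩
  y ∷ x ∷ dyn y x k                    ∎
  where open ≡-Reasoning

IsOrdering : ℤ → ℤ → ℤ × ℤ → Set
IsOrdering a b q = q ≡ (a , b) ⊎ q ≡ (b , a)

ordering-swap : ∀ {q} → IsOrdering a b q → IsOrdering a b (swap q)
ordering-swap (inj₁ refl) = inj₂ refl
ordering-swap (inj₂ refl) = inj₁ refl

ordering-shift : ∀ r {q} → IsOrdering a b q → IsOrdering a b (shift r q)
ordering-shift zero q-ordering = q-ordering
ordering-shift (suc r) q-ordering = ordering-shift r (ordering-swap q-ordering)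

ordering-sym : IsOrdering a b (x , y) → IsOrdering x y (a , b)
ordering-sym (inj₁ refl) = inj₁ refl
ordering-sym (inj₂ refl) = inj₂ refl

ordering-both : ∀ {P : ℤ → Set} → IsOrdering a b (x , y) → P a → P b → P x × P y
ordering-both (inj₁ refl) Pa Pb = Pa , Pb
ordering-both (inj₂ refl) Pa Pb = Pb , Pa

alternate-ordering : ∀ {q} k → IsOrdering a b q →
  alternate q (k ℕ.+ k) ≡ dyn a b k ⊎ alternate q (k ℕ.+ k) ≡ reverse (dyn a b k)
alternate-ordering {a} {b} k (inj₁ refl) = inj₁ (sym (dyn≡alternate a b k))
alternate-ordering {a} {b} k (inj₂ refl) = inj₂ (trans (sym (dyn≡alternate b a k)) (sym (reverse-dyn a b k)))

Pointwise-++⁻ʳ : ∀ {A B : Set} {R : A → B → Set} P l {P′ l′} → length P ≡ length l →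
                 Pointwise R (P ++ P′) (l ++ l′) → Pointwise R P′ l′
Pointwise-++⁻ʳ [] [] _ P′∼l′ = P′∼l′
Pointwise-++⁻ʳ (_ ∷ P) (_ ∷ l) |P|≡|l| (_ ∷ rest) = Pointwise-++⁻ʳ P l (ℕ.suc-injective |P|≡|l|) rest

TupleEq-reflexive : l ≡ l′ → TupleEq m l l′
TupleEq-reflexive refl = Pointwise.refl (λ {x} → ≡mod⇒≈ (≡-refl {x = x}))

-- The blocks of the cyclic word dyn a b k are the alternating words starting with a or with b.
record AlternatingBlock (m : ℕ) (a b : ℤ) (k : ℕ) : Set where
  constructor alternatingBlock
  field
    q : ℤ × ℤ
    L : ℕ
    σ : ℤ
    q-ordering : IsOrdering a b q
    1≤L : 1 ≤ L
    L+3≤2k : L ℕ.+ 3 ≤ k ℕ.+ k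
    σ-unit : IsUnit σ
    corner : m11 (Mn (alternate q L)) ≡ σ [mod m ]

alternatingBlock-suffix : ∀ {q} R B → IsOrdering a b q → TupleEq m (R ++ B) (alternate q (k ℕ.+ k)) →
  3 ≤ length R → 1 ≤ length B → IsUnit δ → m11 (Mn B) ≡ δ [mod m ] → AlternatingBlock m a b k
alternatingBlock-suffix {k = k} {q = q} R B q-ordering R++B≈ 3≤|R| 1≤|B| δ-unit corner =
  alternatingBlock (shift (length R) q) (length B) _ (ordering-shift (length R) q-ordering) 1≤|B|
    |B|+3≤2k δ-unit (≡-trans (≡-sym (m11-Mn-cong B≈)) corner)
  where
  |R|+|B|≡2k : length R ℕ.+ length B ≡ k ℕ.+ k
  |R|+|B|≡2k = trans (sym (List.length-++ R)) (trans (Pointwise-length R++B≈) (length-alternate q (k ℕ.+ k)))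
  B≈ : TupleEq _ B (alternate (shift (length R) q) (length B))
  B≈ = Pointwise-++⁻ʳ R (alternate q (length R)) (sym (length-alternate q (length R)))
         (subst (TupleEq _ (R ++ B))
           (trans (cong (alternate q) (sym |R|+|B|≡2k)) (alternate-+ q (length R) (length B))) R++B≈)
  |B|+3≤2k : length B ℕ.+ 3 ≤ k ℕ.+ k
  |B|+3≤2k = subst (length B ℕ.+ 3 ≤_) (trans (ℕ.+-comm (length B) (length R)) |R|+|B|≡2k)
               (ℕ.+-monoʳ-≤ (length B) 3≤|R|)

blockSplit⇒alternatingBlock : BlockSplit m (dyn a b k) → AlternatingBlock m a b k
blockSplit⇒alternatingBlock {m = m} {a = a} {b = b} {k = k}
  (blockSplit R B σ 3≤|R| 1≤|B| σ-unit corner (r , r<|c| , rotation)) =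
  let q , q-ordering , R++B≈ = phase rotation in
  alternatingBlock-suffix R B q-ordering R++B≈ 3≤|R| 1≤|B| σ-unit corner
  where
  r≤2k : r ≤ k ℕ.+ k
  r≤2k = ℕ.<⇒≤ (subst (r <_) (length-dyn a b k) r<|c|)
  phase : TupleEq m (R ++ B) (rotate r (dyn a b k)) ⊎ TupleEq m (R ++ B) (rotate r (reverse (dyn a b k))) →
          ∃[ q ] (IsOrdering a b q × TupleEq m (R ++ B) (alternate q (k ℕ.+ k)))
  phase (inj₁ R++B≈) =
    shift r (a , b) , ordering-shift r (inj₁ refl) , subst (TupleEq m (R ++ B)) (rotate-dyn a b k r≤2k) R++B≈
  phase (inj₂ R++B≈) =
    shift r (b , a) , ordering-shift r (inj₂ refl) ,
    subst (TupleEq m (R ++ B)) (trans (cong (rotate r) (reverse-dyn a b k)) (rotate-dyn b a k r≤2k)) R++B≈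

alternatingBlock⇒blockSplit : AlternatingBlock m a b k → BlockSplit m (dyn a b k)
alternatingBlock⇒blockSplit {m = m} {a = a} {b = b} {k = k}
  (alternatingBlock q L σ q-ordering 1≤L L+3≤2k σ-unit corner) =
  blockSplit (alternate (shift L q) (N ℕ.∸ L)) (alternate q L) σ 3≤|R|
    (subst (1 ≤_) (sym (length-alternate q L)) 1≤L) σ-unit corner
    (L , L<|c| , Sum.map (λ e → TupleEq-reflexive (split e)) (λ e → TupleEq-reflexive (split e))
                   (alternate-ordering k q-ordering))
  where
  N : ℕ
  N = k ℕ.+ k
  L≤N : L ≤ N
  L≤N = ℕ.≤-trans (ℕ.m≤m+n L 3) L+3≤2k
  L<|c| : L < length (dyn a b k)
  L<|c| = subst (L <_) (sym (length-dyn a b k)) (ℕ.<-≤-trans (ℕ.m<m+n L (s≤s z≤n)) L+3≤2k)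
  3≤|R| : 3 ≤ length (alternate (shift L q) (N ℕ.∸ L))
  3≤|R| = subst (3 ≤_) (sym (length-alternate (shift L q) (N ℕ.∸ L)))
            (subst (_≤ N ℕ.∸ L) (ℕ.m+n∸m≡n L 3) (ℕ.∸-monoˡ-≤ L L+3≤2k))
  split : ∀ {c} → alternate q N ≡ c → alternate (shift L q) (N ℕ.∸ L) ++ alternate q L ≡ rotate L c
  split refl = sym (rotate-alternate q L≤N)

-- Mn (dyn x y j) is the j-th power of P = Ma y ⊗ Ma x, which has trace x y - 2 and
-- determinant 1. By Cayley–Hamilton every power of P is u P + v Id; pencil x y (u , v)
-- is that matrix, and chebyshev gives (u , v).
pencil : ℤ → ℤ → ℤ × ℤ → Mat
pencil x y (u , v) = mat (u * (x * y - 1ℤ) + v) (- (u * y)) (u * x) (v - u)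

chebyshev-step : ℤ → ℤ × ℤ → ℤ × ℤ
chebyshev-step t (u , v) = t * u + v , - u

chebyshev : ℤ → ℕ → ℤ × ℤ
chebyshev t zero = 0ℤ , 1ℤ
chebyshev t (suc j) = chebyshev-step t (chebyshev t j)

pencil-step : ∀ x y w → (pencil x y w ⊗ Ma y) ⊗ Ma x ≡ pencil x y (chebyshev-step (x * y - + 2) w)
pencil-step x y (u , v) = mat-cong (e₁₁ x y u v) (e₁₂ x y u v) (e₂₁ x y u v) (e₂₂ x y u v)
  where
  e₁₁ : ∀ x y u v →
    ((u * (x * y - 1ℤ) + v) * y + (- (u * y)) * 1ℤ) * x + ((u * (x * y - 1ℤ) + v) * -1ℤ + (- (u * y)) * 0ℤ) * 1ℤ
    ≡ ((x * y - + 2) * u + v) * (x * y - 1ℤ) + - u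
  e₁₁ = solve-∀
  e₁₂ : ∀ x y u v →
    ((u * (x * y - 1ℤ) + v) * y + (- (u * y)) * 1ℤ) * -1ℤ + ((u * (x * y - 1ℤ) + v) * -1ℤ + (- (u * y)) * 0ℤ) * 0ℤ
    ≡ - (((x * y - + 2) * u + v) * y)
  e₁₂ = solve-∀
  e₂₁ : ∀ x y u v →
    ((u * x) * y + (v - u) * 1ℤ) * x + ((u * x) * -1ℤ + (v - u) * 0ℤ) * 1ℤ
    ≡ ((x * y - + 2) * u + v) * x
  e₂₁ = solve-∀
  e₂₂ : ∀ x y u v →
    ((u * x) * y + (v - u) * 1ℤ) * -1ℤ + ((u * x) * -1ℤ + (v - u) * 0ℤ) * 0ℤ
    ≡ - u - ((x * y - + 2) * u + v)
  e₂₂ = solve-∀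

Mn-dyn : ∀ x y j → Mn (dyn x y j) ≡ pencil x y (chebyshev (x * y - + 2) j)
Mn-dyn x y zero = refl
Mn-dyn x y (suc j) = begin
  Mn (x ∷ y ∷ dyn x y j)                                      ≡⟨ Mn-∷ x (y ∷ dyn x y j) ⟩
  Mn (y ∷ dyn x y j) ⊗ Ma x                                   ≡⟨ cong (_⊗ Ma x) (Mn-∷ y (dyn x y j)) ⟩
  (Mn (dyn x y j) ⊗ Ma y) ⊗ Ma x                              ≡⟨ cong (λ M → (M ⊗ Ma y) ⊗ Ma x) (Mn-dyn x y j) ⟩
  (pencil x y (chebyshev (x * y - + 2) j) ⊗ Ma y) ⊗ Ma x      ≡⟨ pencil-step x y (chebyshev (x * y - + 2) j) ⟩
  pencil x y (chebyshev (x * y - + 2) (suc j))                ∎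
  where open ≡-Reasoning

dyn-swap-solution : ∀ x y j → Solution m (dyn x y j) → Solution m (dyn y x j)
dyn-swap-solution {m = m} x y j sol with solution⇒scalar (dyn x y j) sol
... | δ , δ-unit , Mn≡δ =
  scalar⇒solution (dyn y x j) δ-unit
    (subst (λ M → M ≡ᴹ scalar δ [mod m ]) (sym Mn-dyn-yx)
      (swapped (subst (λ M → M ≡ᴹ scalar δ [mod m ]) (Mn-dyn x y j) Mn≡δ)))
  where
  w : ℤ × ℤ
  w = chebyshev (x * y - + 2) j
  u v : ℤ
  u = proj₁ w
  v = proj₂ w
  Mn-dyn-yx : Mn (dyn y x j) ≡ pencil y x w
  Mn-dyn-yx = trans (Mn-dyn y x j) (cong (λ t → pencil y x (chebyshev (t - + 2) j)) (ℤ.*-comm y x))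
  i₁₁ : ∀ x y u v δ → u * (y * x - 1ℤ) + v - δ ≡ 1ℤ * (u * (x * y - 1ℤ) + v - δ)
  i₁₁ = solve-∀
  i₁₂ : ∀ x u → - (u * x) - 0ℤ ≡ -1ℤ * (u * x - 0ℤ)
  i₁₂ = solve-∀
  i₂₁ : ∀ y u → u * y - 0ℤ ≡ -1ℤ * (- (u * y) - 0ℤ)
  i₂₁ = solve-∀
  swapped : pencil x y w ≡ᴹ scalar δ [mod m ] → pencil y x w ≡ᴹ scalar δ [mod m ]
  swapped (e₁₁ , e₁₂ , e₂₁ , e₂₂) =
    ≡-combination₁ 1ℤ (i₁₁ x y u v δ) e₁₁ , ≡-combination₁ -1ℤ (i₁₂ x u) e₂₁ ,
    ≡-combination₁ -1ℤ (i₂₁ y u) e₁₂ , e₂₂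

pencil-corner⇒u[u-δ]xy≡0 : ∀ x y u v → IsUnit δ → det (pencil x y (u , v)) ≡ 1ℤ →
  m11 (pencil x y (u , v)) ≡ δ [mod m ] → u * (u - δ) * (x * y) ≡ 0ℤ [mod m ]
pencil-corner⇒u[u-δ]xy≡0 {δ = δ} x y u v δ-unit det≡1 corner =
  ≡-combination₃ (u * (x * y) - δ - (u * (x * y - 1ℤ) + v)) 1ℤ -1ℤ (identity x y u v δ)
    corner (≡-reflexive det≡1) (unit-square δ-unit)
  where
  identity : ∀ x y u v δ →
    u * (u - δ) * (x * y) - 0ℤ
    ≡ (u * (x * y) - δ - (u * (x * y - 1ℤ) + v)) * (u * (x * y - 1ℤ) + v - δ)
      + 1ℤ * ((u * (x * y - 1ℤ) + v) * (v - u) - (- (u * y)) * (u * x) - 1ℤ) + -1ℤ * (δ * δ - 1ℤ)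
  identity = solve-∀

u≡0⇒pencil≡scalar : ∀ x y u v → u ≡ 0ℤ [mod m ] → m11 (pencil x y (u , v)) ≡ δ [mod m ] →
  pencil x y (u , v) ≡ᴹ scalar δ [mod m ]
u≡0⇒pencil≡scalar {δ = δ} x y u v u≡0 corner =
  corner , ≡-combination₁ (- y) (i₁₂ y u) u≡0 , ≡-combination₁ x (i₂₁ x u) u≡0 ,
  ≡-combination₂ 1ℤ (- (x * y)) (i₂₂ x y u v δ) corner u≡0
  where
  i₁₂ : ∀ y u → - (u * y) - 0ℤ ≡ (- y) * (u - 0ℤ)
  i₁₂ = solve-∀
  i₂₁ : ∀ x u → u * x - 0ℤ ≡ x * (u - 0ℤ)
  i₂₁ = solve-∀
  i₂₂ : ∀ x y u v δ → v - u - δ ≡ 1ℤ * (u * (x * y - 1ℤ) + v - δ) + (- (x * y)) * (u - 0ℤ)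
  i₂₂ = solve-∀

u≡δ⇒pencil-step≡-scalar : ∀ x y u v → u ≡ δ [mod m ] → m11 (pencil x y (u , v)) ≡ δ [mod m ] →
  pencil x y (chebyshev-step (x * y - + 2) (u , v)) ≡ᴹ scalar (- δ) [mod m ]
u≡δ⇒pencil-step≡-scalar {δ = δ} x y u v u≡δ corner =
  ≡-combination₂ (x * y - 1ℤ) (- (x * y)) (i₁₁ x y u v δ) corner u≡δ ,
  ≡-combination₂ (- y) y (i₁₂ x y u v δ) corner u≡δ ,
  ≡-combination₂ x (- x) (i₂₁ x y u v δ) corner u≡δ ,
  ≡-combination₁ -1ℤ (i₂₂ x y u v δ) corner
  where
  i₁₁ : ∀ x y u v δ → ((x * y - + 2) * u + v) * (x * y - 1ℤ) + - u - - δ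
        ≡ (x * y - 1ℤ) * (u * (x * y - 1ℤ) + v - δ) + (- (x * y)) * (u - δ)
  i₁₁ = solve-∀
  i₁₂ : ∀ x y u v δ → - (((x * y - + 2) * u + v) * y) - 0ℤ
        ≡ (- y) * (u * (x * y - 1ℤ) + v - δ) + y * (u - δ)
  i₁₂ = solve-∀
  i₂₁ : ∀ x y u v δ → ((x * y - + 2) * u + v) * x - 0ℤ
        ≡ x * (u * (x * y - 1ℤ) + v - δ) + (- x) * (u - δ)
  i₂₁ = solve-∀
  i₂₂ : ∀ x y u v δ → - u - ((x * y - + 2) * u + v) - - δ ≡ -1ℤ * (u * (x * y - 1ℤ) + v - δ)
  i₂₂ = solve-∀

even-corner⇒solution : ∀ {p} → Prime p → ¬ (x ≡ 0ℤ [mod p ]) → ¬ (y ≡ 0ℤ [mod p ]) → IsUnit δ →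
  m11 (Mn (dyn x y j)) ≡ δ [mod p ^ n ] →
  Solution (p ^ n) (dyn x y j) ⊎ Solution (p ^ n) (dyn x y (suc j))
even-corner⇒solution {x = x} {y = y} {δ = δ} {j = j} {n = n} {p = p} p-prime x≢0 y≢0 δ-unit corner =
  Sum.map
    (λ u≡0 → scalar⇒solution (dyn x y j) δ-unit
               (subst (λ M → M ≡ᴹ scalar δ [mod p ^ n ]) (sym (Mn-dyn x y j))
                 (u≡0⇒pencil≡scalar x y u v u≡0 corner′)))
    (λ u≡δ → scalar⇒solution (dyn x y (suc j)) (unit-neg δ-unit)
               (subst (λ M → M ≡ᴹ scalar (- δ) [mod p ^ n ]) (sym (Mn-dyn x y (suc j)))
                 (u≡δ⇒pencil-step≡-scalar x y u v u≡δ corner′)))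
    (u[u-δ]c≡0⇒u≡0∨u≡δ {n = n} p-prime δ-unit (prime-*≢0 p-prime x≢0 y≢0)
      (pencil-corner⇒u[u-δ]xy≡0 x y u v δ-unit det≡1 corner′))
  where
  u v : ℤ
  u = proj₁ (chebyshev (x * y - + 2) j)
  v = proj₂ (chebyshev (x * y - + 2) j)
  corner′ : m11 (pencil x y (u , v)) ≡ δ [mod p ^ n ]
  corner′ = subst (λ M → m11 M ≡ δ [mod p ^ n ]) (Mn-dyn x y j) corner
  det≡1 : det (pencil x y (u , v)) ≡ 1ℤ
  det≡1 = trans (cong det (sym (Mn-dyn x y j))) (det-Mn (dyn x y j))

-- Odd blocks and the period of a solution

dyn-+ : ∀ x y i j → dyn x y (i ℕ.+ j) ≡ dyn x y i ++ dyn x y j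
dyn-+ x y zero j = refl
dyn-+ x y (suc i) j = cong (λ l → x ∷ y ∷ l) (dyn-+ x y i j)

m11-++-scalar : ∀ l w → Mn w ≡ᴹ scalar ε [mod m ] → m11 (Mn (l ++ w)) ≡ ε * m11 (Mn l) [mod m ]
m11-++-scalar {ε = ε} {m = m} l w (e₁₁ , e₁₂ , _ , _) =
  subst (λ M → m11 M ≡ ε * m11 (Mn l) [mod m ]) (sym (Mn-++ l w))
    (≡-combination₂ (m11 (Mn l)) (m21 (Mn l)) (identity (m11 (Mn w)) (m12 (Mn w)) (m11 (Mn l)) (m21 (Mn l)) ε)
      e₁₁ e₁₂)
  where
  identity : ∀ a b c d ε → a * c + b * d - ε * c ≡ c * (a - ε) + d * (b - 0ℤ)
  identity = solve-∀

oddCorner : ℤ → ℤ → ℕ → ℤ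
oddCorner x y i = m11 (Mn (x ∷ dyn y x i))

-- Appending the solution dyn y x k multiplies the matrix by ±Id modulo m.
oddCorner-period : Solution m (dyn y x k) → ∀ q s →
  ∃[ σ ] (IsUnit σ × oddCorner x y (s ℕ.+ q ℕ.* k) ≡ σ * oddCorner x y s [mod m ])
oddCorner-period {y = y} {x = x} sol zero s =
  1ℤ , inj₁ refl , ≡-reflexive (trans (cong (oddCorner x y) (ℕ.+-identityʳ s)) (sym (ℤ.*-identityˡ _)))
oddCorner-period {m = m} {y = y} {x = x} {k = k} sol (suc q) s
  with oddCorner-period sol q s | solution⇒scalar (dyn y x k) sol
... | σ , σ-unit , period | ε , ε-unit , Mn≡ε =
  ε * σ , unit-* ε-unit σ-unit ,
  ≡-combination₂ 1ℤ ε (identity (oddCorner x y (s ℕ.+ suc q ℕ.* k)) (oddCorner x y i) (oddCorner x y s) ε σ)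
    (subst (λ i′ → oddCorner x y i′ ≡ ε * oddCorner x y i [mod m ]) indices one-more-period) period
  where
  i : ℕ
  i = s ℕ.+ q ℕ.* k
  indices : i ℕ.+ k ≡ s ℕ.+ suc q ℕ.* k
  indices = trans (ℕ.+-assoc s (q ℕ.* k) k) (cong (s ℕ.+_) (ℕ.+-comm (q ℕ.* k) k))
  one-more-period : oddCorner x y (i ℕ.+ k) ≡ ε * oddCorner x y i [mod m ]
  one-more-period =
    subst (λ l → m11 (Mn l) ≡ ε * oddCorner x y i [mod m ]) (cong (x ∷_) (sym (dyn-+ y x i k)))
      (m11-++-scalar (x ∷ dyn y x i) (dyn y x k) Mn≡ε)
  identity : ∀ a c b ε σ → a - ε * σ * b ≡ 1ℤ * (a - ε * c) + ε * (c - σ * b)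
  identity = solve-∀

ShortOddUnitCorner : ℕ → ℤ → ℤ → ℕ → Set
ShortOddUnitCorner m x y k = ∃[ s ] (suc s < k × ∃[ σ ] (IsUnit σ × oddCorner x y s ≡ σ [mod m ]))

-- Reducing the length modulo the period; the length 2 k - 1 is excluded because
-- y followed by that block is the solution dyn y x k, which forces its corner to vanish.
odd-corner-shorten : 2 ≤ m → 1 ≤ k → Solution m (dyn y x k) → IsUnit δ →
  oddCorner x y j ≡ δ [mod m ] → ShortOddUnitCorner m x y k
odd-corner-shorten {m = m} {k = k} {y = y} {x = x} {δ = δ} {j = j} 2≤m 1≤k sol δ-unit corner =
  reduce (oddCorner-period sol (j / k) (j % k))
  where
  instance
    k-nonZero : ℕ.NonZero k
    k-nonZero = ℕ.>-nonZero 1≤k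
  shorten : ∀ s {τ} → s < k → IsUnit τ → oddCorner x y s ≡ τ [mod m ] → ShortOddUnitCorner m x y k
  shorten s {τ} s<k τ-unit corner-s with ℕ.m≤n⇒m<n∨m≡n s<k
  ... | inj₁ 1+s<k = s , 1+s<k , τ , τ-unit , corner-s
  ... | inj₂ 1+s≡k = ⊥-elim (unit-≢0 2≤m τ-unit (≡-trans (≡-sym corner-s)
          (solution-∷⇒m11≡0 y (x ∷ dyn y x s) (subst (λ i → Solution m (dyn y x i)) (sym 1+s≡k) sol))))
  Aⱼ Aᵣ : ℤ
  Aⱼ = oddCorner x y j
  Aᵣ = oddCorner x y (j % k)
  identity : ∀ Aⱼ Aᵣ σ δ → Aᵣ - σ * δ ≡ (- Aᵣ) * (σ * σ - 1ℤ) + (- σ) * (Aⱼ - σ * Aᵣ) + σ * (Aⱼ - δ)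
  identity = solve-∀
  reduce : ∃[ σ ] (IsUnit σ × oddCorner x y (j % k ℕ.+ j / k ℕ.* k) ≡ σ * Aᵣ [mod m ]) →
           ShortOddUnitCorner m x y k
  reduce (σ , σ-unit , period) =
    shorten (j % k) (m%n<n j k) (unit-* σ-unit δ-unit)
      (≡-combination₃ (- Aᵣ) (- σ) σ (identity Aⱼ Aᵣ σ δ) (unit-square σ-unit) period′ corner)
    where
    period′ : Aⱼ ≡ σ * Aᵣ [mod m ]
    period′ = subst (λ i → oddCorner x y i ≡ σ * Aᵣ [mod m ]) (sym (m≡m%n+[m/n]*n j k)) period

ordering-solution : IsOrdering a b (x , y) → ∀ j → Solution m (dyn a b j) → Solution m (dyn x y j)
ordering-solution (inj₁ refl) j = id
ordering-solution {a = a} {b = b} (inj₂ refl) j = dyn-swap-solution a b j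

even-block⇒solution : ∀ {p q} → Prime p → ¬ (a ≡ 0ℤ [mod p ]) → ¬ (b ≡ 0ℤ [mod p ]) →
  IsOrdering a b q → IsUnit δ → m11 (Mn (alternate q (j ℕ.+ j))) ≡ δ [mod p ^ n ] →
  Solution (p ^ n) (dyn a b j) ⊎ Solution (p ^ n) (dyn a b (suc j))
even-block⇒solution {δ = δ} {j = j} {n = n} {p = p} {q = x , y} p-prime a≢0 b≢0 q-ordering δ-unit corner =
  Sum.map (ordering-solution (ordering-sym q-ordering) j) (ordering-solution (ordering-sym q-ordering) (suc j))
    (even-corner⇒solution {j = j} {n = n} p-prime (proj₁ x≢0×y≢0) (proj₂ x≢0×y≢0) δ-unit
      (subst (λ l → m11 (Mn l) ≡ δ [mod p ^ n ]) (sym (dyn≡alternate x y j)) corner))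
  where
  x≢0×y≢0 : ¬ (x ≡ 0ℤ [mod p ]) × ¬ (y ≡ 0ℤ [mod p ])
  x≢0×y≢0 = ordering-both {P = λ z → ¬ (z ≡ 0ℤ [mod p ])} q-ordering a≢0 b≢0

odd-block-shorten : ∀ {q} → 2 ≤ m → 1 ≤ k → Solution m (dyn a b k) → IsOrdering a b q → IsUnit δ →
  m11 (Mn (alternate q (suc (j ℕ.+ j)))) ≡ δ [mod m ] → AlternatingBlock m a b k
odd-block-shorten {m = m} {k = k} {δ = δ} {j = j} {q = x , y} 2≤m 1≤k sol q-ordering δ-unit corner
  with odd-corner-shorten {j = j} 2≤m 1≤k (ordering-solution (ordering-swap q-ordering) k sol) δ-unit
         (subst (λ l → m11 (Mn (x ∷ l)) ≡ δ [mod m ]) (sym (dyn≡alternate y x j)) corner)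
... | s , 1+s<k , σ , σ-unit , corner-s =
  alternatingBlock (x , y) (suc (s ℕ.+ s)) σ q-ordering (s≤s z≤n) length-bound σ-unit
    (subst (λ l → m11 (Mn (x ∷ l)) ≡ σ [mod m ]) (dyn≡alternate y x s) corner-s)
  where
  length-bound : suc (s ℕ.+ s) ℕ.+ 3 ≤ k ℕ.+ k
  length-bound = subst (_≤ k ℕ.+ k) (2+s+2+s s) (ℕ.+-mono-≤ 1+s<k 1+s<k)
    where
    2+s+2+s : ∀ s → suc (suc s) ℕ.+ suc (suc s) ≡ suc (s ℕ.+ s) ℕ.+ 3
    2+s+2+s = ℕ-solve-∀

j+j+3≤k+k⇒1+j<k : ∀ j k → j ℕ.+ j ℕ.+ 3 ≤ k ℕ.+ k → suc j < k
j+j+3≤k+k⇒1+j<k zero zero ()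
j+j+3≤k+k⇒1+j<k zero (suc zero) (s≤s (s≤s ()))
j+j+3≤k+k⇒1+j<k zero (suc (suc k)) _ = s≤s (s≤s z≤n)
j+j+3≤k+k⇒1+j<k (suc j) zero ()
j+j+3≤k+k⇒1+j<k (suc j) (suc k) h rewrite ℕ.+-suc j j | ℕ.+-suc k k with h
... | s≤s (s≤s h′) = s≤s (j+j+3≤k+k⇒1+j<k j k h′)

1≤j+j⇒1≤j : ∀ j → 1 ≤ j ℕ.+ j → 1 ≤ j
1≤j+j⇒1≤j (suc j) _ = s≤s z≤n

data Parity : ℕ → Set where
  even : ∀ j → Parity (j ℕ.+ j)
  odd : ∀ j → Parity (suc (j ℕ.+ j))

parity : ∀ n → Parity n
parity zero = even zero
parity (suc n) with parity n
... | even j = odd j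
... | odd j = subst Parity (cong suc (ℕ.+-suc j j)) (even (suc j))

3≤length-dyn : ∀ {m} a b k → ¬ (b ≡ 0ℤ [mod m ]) → 1 ≤ k → Solution m (dyn a b k) → 3 ≤ length (dyn a b k)
3≤length-dyn a b (suc zero) b≢0 _ sol =
  ⊥-elim (b≢0 (≡-combination₁ 1ℤ (identity b) (solution-∷⇒m11≡0 a (b ∷ []) sol)))
  where
  identity : ∀ b → b - 0ℤ ≡ 1ℤ * ((b * 1ℤ + -1ℤ * 0ℤ) - 0ℤ)
  identity = solve-∀
3≤length-dyn a b (suc (suc k)) _ _ _ = s≤s (s≤s (s≤s z≤n))

proposition5p11 : (p n : ℕ) → Prime p → 5 ≤ p → 1 ≤ n → (a b : ℤ) →
    ¬ ((+ p) ∣ a) → ¬ ((+ p) ∣ b) → ¬ (a ≈[ p ] b) →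
    (k : ℕ) → IsDynMinSol p a b k → Irreducible p (dyn a b k) →
    (k′ : ℕ) → IsDynMinSol (p ^ n) a b k′ → Irreducible (p ^ n) (dyn a b k′)
proposition5p11 p zero _ _ ()
proposition5p11 p (suc n) p-prime _ _ a b p∤a p∤b _ k (1≤k , sol , _) (_ , _ , irreducible)
                k′ (1≤k′ , sol′ , minimal′) =
  sol′ , 3≤length-dyn a b k′ (b≢0 ∘ ≡-mod-∣ p∣p^[1+n]) 1≤k′ sol′ ,
  no-block ∘ blockSplit⇒alternatingBlock ∘ reducible⇒blockSplit
  where
  p∣p^[1+n] : p ℕ.∣ p ^ suc n
  p∣p^[1+n] = ℕ.m∣m*n (p ^ n)
  a≢0 : ¬ (a ≡ 0ℤ [mod p ])
  a≢0 = p∤a ∘ ≡0⇒∣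
  b≢0 : ¬ (b ≡ 0ℤ [mod p ])
  b≢0 = p∤b ∘ ≡0⇒∣
  no-block : AlternatingBlock (p ^ suc n) a b k′ → ⊥
  no-block (alternatingBlock q L δ q-ordering 1≤L L+3≤2k′ δ-unit corner) with parity L
  ... | even j = Sum.[ minimal′ j (1≤j+j⇒1≤j j 1≤L) (ℕ.<-trans (ℕ.n<1+n j) (j+j+3≤k+k⇒1+j<k j k′ L+3≤2k′))
                     , minimal′ (suc j) (s≤s z≤n) (j+j+3≤k+k⇒1+j<k j k′ L+3≤2k′) ]′
                   (even-block⇒solution {j = j} {n = suc n} p-prime a≢0 b≢0 q-ordering δ-unit corner)
  ... | odd j = irreducible (blockSplit⇒reducible (alternatingBlock⇒blockSplit
                  (odd-block-shorten {j = j} (prime⇒2≤ p-prime) 1≤k sol q-ordering δ-unit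
                    (≡-mod-∣ p∣p^[1+n] corner))))
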